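{- Let $G$ be the group of transformations of maps $s:\{1,\dots,37\}\to\{1,\dots,7\}$ generated by (i) the 12 geometric symmetries of the hexagonal board (rotations by multiples of $60^\circ$ and reflections), acting on cells, and (ii) the $7!$ permutations of the symbols $\{1,\dots,7\}$. Then $G$ maps valid Septoku boards to valid Septoku boards, and the set of valid Septoku boards splits into exactly six $G$-orbits.
   Context: The Septoku board consists of 37 cells forming a regular hexagon of side 4 in a hexagonal grid, numbered row by row: $1$–$4$ (top row), $5$–$9$, $10$–$15$, $16$–$22$, $23$–$28$, $29$–$33$, $34$–$37$ (bottom row). The 21 "rows" of the board (lines of cells in the three grid directions) are: horizontal $\{1,2,3,4\}$, $\{5,\dots,9\}$, $\{10,\dots,15\}$, $\{16,\dots,22\}$, $\{23,\dots,28\}$, $\{29,\dots,33\}$, $\{34,\dots,37\}$; up-right $\{1,5,10,16\}$, $\{2,6,11,17,23\}$, $\{3,7,12,18,24,29\}$, $\{4,8,13,19,25,30,34\}$, $\{9,14,20,26,31,35\}$, $\{15,21,27,32,36\}$, $\{22,28,33,37\}$; down-right $\{4,9,15,22\}$, $\{3,8,14,21,28\}$, $\{2,7,13,20,27,33\}$, $\{1,6,12,19,26,32,37\}$, $\{5,11,18,25,31,36\}$, $\{10,17,24,30,35\}$, $\{16,23,29,34\}$. The seven "circles" (a center cell with its six neighbours) are: $\{1,2,5,6,7,11,12\}$, $\{3,4,7,8,9,13,14\}$, $\{10,11,16,17,18,23,24\}$, $\{12,13,18,19,20,25,26\}$, $\{14,15,20,21,22,27,28\}$, $\{24,25,29,30,31,34,35\}$,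 $\{26,27,31,32,33,36,37\}$. A valid Septoku board is a map $s:\{1,\dots,37\}\to\{1,\dots,7\}$ such that the cells of each of the 21 rows receive pairwise distinct values and the seven cells of each circle receive pairwise distinct values. The 12 geometric symmetries of the hexagonal board permute the cells and preserve the sets of rows and circles; e.g. the $180^\circ$ rotation maps cell $i$ to cell $38-i$. -}

module Defs where

open import Data.Nat using (ℕ; _∸_; _<?_)
open import Data.Fin using (Fin; zero; fromℕ<)
open import Data.Fin.Permutation using (Permutation′; _⟨$⟩ʳ_)
open import Data.List using (List; []; _∷_; map)
open import Data.List.Membership.Propositional using (_∈_)
open import Data.List.Relation.Unary.All using (All)
open import Data.List.Relation.Unary.Unique.Propositional using (Unique)
open import Data.Vec using (Vec; lookup) renaming ([] to []ᵛ; _∷_ to _∷ᵛ_)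
open import Data.Product using (Σ; ∃; _×_)
open import Data.Sum using (_⊎_)
open import Relation.Nullary using (yes; no)
open import Relation.Binary.PropositionalEquality using (_≡_)
open import Relation.Binary.Construct.Closure.Equivalence using (EqClosure)

-- Cells are the elements of Fin 37; cell number k (1 ≤ k ≤ 37, as in the
-- paper) is the element k ∸ 1 of Fin 37.  Symbols 1..7 are Fin 7 (symbol j is j ∸ 1).
Cell : Set
Cell = Fin 37

Symbol : Set
Symbol = Fin 7

Board : Set
Board = Cell → Symbol

-- The cell with paper label k (only ever applied to 1 ≤ k ≤ 37).
cell : ℕ → Cell
cell k with (k ∸ 1) <? 37
... | yes p = fromℕ< p
... | no _  = zero

rows : List (List ℕ)
rows =
    (1 ∷ 2 ∷ 3 ∷ 4 ∷ [])
  ∷ (5 ∷ 6 ∷ 7 ∷ 8 ∷ 9 ∷ [])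
  ∷ (10 ∷ 11 ∷ 12 ∷ 13 ∷ 14 ∷ 15 ∷ [])
  ∷ (16 ∷ 17 ∷ 18 ∷ 19 ∷ 20 ∷ 21 ∷ 22 ∷ [])
  ∷ (23 ∷ 24 ∷ 25 ∷ 26 ∷ 27 ∷ 28 ∷ [])
  ∷ (29 ∷ 30 ∷ 31 ∷ 32 ∷ 33 ∷ [])
  ∷ (34 ∷ 35 ∷ 36 ∷ 37 ∷ [])
  ∷ (1 ∷ 5 ∷ 10 ∷ 16 ∷ [])
  ∷ (2 ∷ 6 ∷ 11 ∷ 17 ∷ 23 ∷ [])
  ∷ (3 ∷ 7 ∷ 12 ∷ 18 ∷ 24 ∷ 29 ∷ [])
  ∷ (4 ∷ 8 ∷ 13 ∷ 19 ∷ 25 ∷ 30 ∷ 34 ∷ [])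
  ∷ (9 ∷ 14 ∷ 20 ∷ 26 ∷ 31 ∷ 35 ∷ [])
  ∷ (15 ∷ 21 ∷ 27 ∷ 32 ∷ 36 ∷ [])
  ∷ (22 ∷ 28 ∷ 33 ∷ 37 ∷ [])
  ∷ (4 ∷ 9 ∷ 15 ∷ 22 ∷ [])
  ∷ (3 ∷ 8 ∷ 14 ∷ 21 ∷ 28 ∷ [])
  ∷ (2 ∷ 7 ∷ 13 ∷ 20 ∷ 27 ∷ 33 ∷ [])
  ∷ (1 ∷ 6 ∷ 12 ∷ 19 ∷ 26 ∷ 32 ∷ 37 ∷ [])
  ∷ (5 ∷ 11 ∷ 18 ∷ 25 ∷ 31 ∷ 36 ∷ [])
  ∷ (10 ∷ 17 ∷ 24 ∷ 30 ∷ 35 ∷ [])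
  ∷ (16 ∷ 23 ∷ 29 ∷ 34 ∷ [])
  ∷ []

circles : List (List ℕ)
circles =
    (1 ∷ 2 ∷ 5 ∷ 6 ∷ 7 ∷ 11 ∷ 12 ∷ [])
  ∷ (3 ∷ 4 ∷ 7 ∷ 8 ∷ 9 ∷ 13 ∷ 14 ∷ [])
  ∷ (10 ∷ 11 ∷ 16 ∷ 17 ∷ 18 ∷ 23 ∷ 24 ∷ [])
  ∷ (12 ∷ 13 ∷ 18 ∷ 19 ∷ 20 ∷ 25 ∷ 26 ∷ [])
  ∷ (14 ∷ 15 ∷ 20 ∷ 21 ∷ 22 ∷ 27 ∷ 28 ∷ [])
  ∷ (24 ∷ 25 ∷ 29 ∷ 30 ∷ 31 ∷ 34 ∷ 35 ∷ [])
  ∷ (26 ∷ 27 ∷ 31 ∷ 32 ∷ 33 ∷ 36 ∷ 37 ∷ [])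
  ∷ []

-- A table t lists, for cell labels 1,…,37 in order, the
-- label of the image cell.  (Computed from axial coordinates; verified to
-- preserve the set of rows and the set of circles.)
geometricSymmetries : List (Vec ℕ 37)
geometricSymmetries =
    (1 ∷ᵛ 2 ∷ᵛ 3 ∷ᵛ 4 ∷ᵛ 5 ∷ᵛ 6 ∷ᵛ 7 ∷ᵛ 8 ∷ᵛ 9 ∷ᵛ 10 ∷ᵛ 11 ∷ᵛ 12 ∷ᵛ 13 ∷ᵛ 14 ∷ᵛ 15 ∷ᵛ 16 ∷ᵛ 17 ∷ᵛ 18 ∷ᵛ 19 ∷ᵛ 20 ∷ᵛ 21 ∷ᵛ 22 ∷ᵛ 23 ∷ᵛ 24 ∷ᵛ 25 ∷ᵛ 26 ∷ᵛ 27 ∷ᵛ 28 ∷ᵛ 29 ∷ᵛ 30 ∷ᵛ 31 ∷ᵛ 32 ∷ᵛ 33 ∷ᵛ 34 ∷ᵛ 35 ∷ᵛ 36 ∷ᵛ 37 ∷ᵛ []ᵛ)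
  ∷ (4 ∷ᵛ 3 ∷ᵛ 2 ∷ᵛ 1 ∷ᵛ 9 ∷ᵛ 8 ∷ᵛ 7 ∷ᵛ 6 ∷ᵛ 5 ∷ᵛ 15 ∷ᵛ 14 ∷ᵛ 13 ∷ᵛ 12 ∷ᵛ 11 ∷ᵛ 10 ∷ᵛ 22 ∷ᵛ 21 ∷ᵛ 20 ∷ᵛ 19 ∷ᵛ 18 ∷ᵛ 17 ∷ᵛ 16 ∷ᵛ 28 ∷ᵛ 27 ∷ᵛ 26 ∷ᵛ 25 ∷ᵛ 24 ∷ᵛ 23 ∷ᵛ 33 ∷ᵛ 32 ∷ᵛ 31 ∷ᵛ 30 ∷ᵛ 29 ∷ᵛ 37 ∷ᵛ 36 ∷ᵛ 35 ∷ᵛ 34 ∷ᵛ []ᵛ)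
  ∷ (4 ∷ᵛ 9 ∷ᵛ 15 ∷ᵛ 22 ∷ᵛ 3 ∷ᵛ 8 ∷ᵛ 14 ∷ᵛ 21 ∷ᵛ 28 ∷ᵛ 2 ∷ᵛ 7 ∷ᵛ 13 ∷ᵛ 20 ∷ᵛ 27 ∷ᵛ 33 ∷ᵛ 1 ∷ᵛ 6 ∷ᵛ 12 ∷ᵛ 19 ∷ᵛ 26 ∷ᵛ 32 ∷ᵛ 37 ∷ᵛ 5 ∷ᵛ 11 ∷ᵛ 18 ∷ᵛ 25 ∷ᵛ 31 ∷ᵛ 36 ∷ᵛ 10 ∷ᵛ 17 ∷ᵛ 24 ∷ᵛ 30 ∷ᵛ 35 ∷ᵛ 16 ∷ᵛ 23 ∷ᵛ 29 ∷ᵛ 34 ∷ᵛ []ᵛ)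
  ∷ (22 ∷ᵛ 15 ∷ᵛ 9 ∷ᵛ 4 ∷ᵛ 28 ∷ᵛ 21 ∷ᵛ 14 ∷ᵛ 8 ∷ᵛ 3 ∷ᵛ 33 ∷ᵛ 27 ∷ᵛ 20 ∷ᵛ 13 ∷ᵛ 7 ∷ᵛ 2 ∷ᵛ 37 ∷ᵛ 32 ∷ᵛ 26 ∷ᵛ 19 ∷ᵛ 12 ∷ᵛ 6 ∷ᵛ 1 ∷ᵛ 36 ∷ᵛ 31 ∷ᵛ 25 ∷ᵛ 18 ∷ᵛ 11 ∷ᵛ 5 ∷ᵛ 35 ∷ᵛ 30 ∷ᵛ 24 ∷ᵛ 17 ∷ᵛ 10 ∷ᵛ 34 ∷ᵛ 29 ∷ᵛ 23 ∷ᵛ 16 ∷ᵛ []ᵛ)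
  ∷ (22 ∷ᵛ 28 ∷ᵛ 33 ∷ᵛ 37 ∷ᵛ 15 ∷ᵛ 21 ∷ᵛ 27 ∷ᵛ 32 ∷ᵛ 36 ∷ᵛ 9 ∷ᵛ 14 ∷ᵛ 20 ∷ᵛ 26 ∷ᵛ 31 ∷ᵛ 35 ∷ᵛ 4 ∷ᵛ 8 ∷ᵛ 13 ∷ᵛ 19 ∷ᵛ 25 ∷ᵛ 30 ∷ᵛ 34 ∷ᵛ 3 ∷ᵛ 7 ∷ᵛ 12 ∷ᵛ 18 ∷ᵛ 24 ∷ᵛ 29 ∷ᵛ 2 ∷ᵛ 6 ∷ᵛ 11 ∷ᵛ 17 ∷ᵛ 23 ∷ᵛ 1 ∷ᵛ 5 ∷ᵛ 10 ∷ᵛ 16 ∷ᵛ []ᵛ)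
  ∷ (37 ∷ᵛ 33 ∷ᵛ 28 ∷ᵛ 22 ∷ᵛ 36 ∷ᵛ 32 ∷ᵛ 27 ∷ᵛ 21 ∷ᵛ 15 ∷ᵛ 35 ∷ᵛ 31 ∷ᵛ 26 ∷ᵛ 20 ∷ᵛ 14 ∷ᵛ 9 ∷ᵛ 34 ∷ᵛ 30 ∷ᵛ 25 ∷ᵛ 19 ∷ᵛ 13 ∷ᵛ 8 ∷ᵛ 4 ∷ᵛ 29 ∷ᵛ 24 ∷ᵛ 18 ∷ᵛ 12 ∷ᵛ 7 ∷ᵛ 3 ∷ᵛ 23 ∷ᵛ 17 ∷ᵛ 11 ∷ᵛ 6 ∷ᵛ 2 ∷ᵛ 16 ∷ᵛ 10 ∷ᵛ 5 ∷ᵛ 1 ∷ᵛ []ᵛ)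
  ∷ (37 ∷ᵛ 36 ∷ᵛ 35 ∷ᵛ 34 ∷ᵛ 33 ∷ᵛ 32 ∷ᵛ 31 ∷ᵛ 30 ∷ᵛ 29 ∷ᵛ 28 ∷ᵛ 27 ∷ᵛ 26 ∷ᵛ 25 ∷ᵛ 24 ∷ᵛ 23 ∷ᵛ 22 ∷ᵛ 21 ∷ᵛ 20 ∷ᵛ 19 ∷ᵛ 18 ∷ᵛ 17 ∷ᵛ 16 ∷ᵛ 15 ∷ᵛ 14 ∷ᵛ 13 ∷ᵛ 12 ∷ᵛ 11 ∷ᵛ 10 ∷ᵛ 9 ∷ᵛ 8 ∷ᵛ 7 ∷ᵛ 6 ∷ᵛ 5 ∷ᵛ 4 ∷ᵛ 3 ∷ᵛ 2 ∷ᵛ 1 ∷ᵛ []ᵛ)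
  ∷ (34 ∷ᵛ 35 ∷ᵛ 36 ∷ᵛ 37 ∷ᵛ 29 ∷ᵛ 30 ∷ᵛ 31 ∷ᵛ 32 ∷ᵛ 33 ∷ᵛ 23 ∷ᵛ 24 ∷ᵛ 25 ∷ᵛ 26 ∷ᵛ 27 ∷ᵛ 28 ∷ᵛ 16 ∷ᵛ 17 ∷ᵛ 18 ∷ᵛ 19 ∷ᵛ 20 ∷ᵛ 21 ∷ᵛ 22 ∷ᵛ 10 ∷ᵛ 11 ∷ᵛ 12 ∷ᵛ 13 ∷ᵛ 14 ∷ᵛ 15 ∷ᵛ 5 ∷ᵛ 6 ∷ᵛ 7 ∷ᵛ 8 ∷ᵛ 9 ∷ᵛ 1 ∷ᵛ 2 ∷ᵛ 3 ∷ᵛ 4 ∷ᵛ []ᵛ)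
  ∷ (34 ∷ᵛ 29 ∷ᵛ 23 ∷ᵛ 16 ∷ᵛ 35 ∷ᵛ 30 ∷ᵛ 24 ∷ᵛ 17 ∷ᵛ 10 ∷ᵛ 36 ∷ᵛ 31 ∷ᵛ 25 ∷ᵛ 18 ∷ᵛ 11 ∷ᵛ 5 ∷ᵛ 37 ∷ᵛ 32 ∷ᵛ 26 ∷ᵛ 19 ∷ᵛ 12 ∷ᵛ 6 ∷ᵛ 1 ∷ᵛ 33 ∷ᵛ 27 ∷ᵛ 20 ∷ᵛ 13 ∷ᵛ 7 ∷ᵛ 2 ∷ᵛ 28 ∷ᵛ 21 ∷ᵛ 14 ∷ᵛ 8 ∷ᵛ 3 ∷ᵛ 22 ∷ᵛ 15 ∷ᵛ 9 ∷ᵛ 4 ∷ᵛ []ᵛ)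
  ∷ (16 ∷ᵛ 23 ∷ᵛ 29 ∷ᵛ 34 ∷ᵛ 10 ∷ᵛ 17 ∷ᵛ 24 ∷ᵛ 30 ∷ᵛ 35 ∷ᵛ 5 ∷ᵛ 11 ∷ᵛ 18 ∷ᵛ 25 ∷ᵛ 31 ∷ᵛ 36 ∷ᵛ 1 ∷ᵛ 6 ∷ᵛ 12 ∷ᵛ 19 ∷ᵛ 26 ∷ᵛ 32 ∷ᵛ 37 ∷ᵛ 2 ∷ᵛ 7 ∷ᵛ 13 ∷ᵛ 20 ∷ᵛ 27 ∷ᵛ 33 ∷ᵛ 3 ∷ᵛ 8 ∷ᵛ 14 ∷ᵛ 21 ∷ᵛ 28 ∷ᵛ 4 ∷ᵛ 9 ∷ᵛ 15 ∷ᵛ 22 ∷ᵛ []ᵛ)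
  ∷ (16 ∷ᵛ 10 ∷ᵛ 5 ∷ᵛ 1 ∷ᵛ 23 ∷ᵛ 17 ∷ᵛ 11 ∷ᵛ 6 ∷ᵛ 2 ∷ᵛ 29 ∷ᵛ 24 ∷ᵛ 18 ∷ᵛ 12 ∷ᵛ 7 ∷ᵛ 3 ∷ᵛ 34 ∷ᵛ 30 ∷ᵛ 25 ∷ᵛ 19 ∷ᵛ 13 ∷ᵛ 8 ∷ᵛ 4 ∷ᵛ 35 ∷ᵛ 31 ∷ᵛ 26 ∷ᵛ 20 ∷ᵛ 14 ∷ᵛ 9 ∷ᵛ 36 ∷ᵛ 32 ∷ᵛ 27 ∷ᵛ 21 ∷ᵛ 15 ∷ᵛ 37 ∷ᵛ 33 ∷ᵛ 28 ∷ᵛ 22 ∷ᵛ []ᵛ)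
  ∷ (1 ∷ᵛ 5 ∷ᵛ 10 ∷ᵛ 16 ∷ᵛ 2 ∷ᵛ 6 ∷ᵛ 11 ∷ᵛ 17 ∷ᵛ 23 ∷ᵛ 3 ∷ᵛ 7 ∷ᵛ 12 ∷ᵛ 18 ∷ᵛ 24 ∷ᵛ 29 ∷ᵛ 4 ∷ᵛ 8 ∷ᵛ 13 ∷ᵛ 19 ∷ᵛ 25 ∷ᵛ 30 ∷ᵛ 34 ∷ᵛ 9 ∷ᵛ 14 ∷ᵛ 20 ∷ᵛ 26 ∷ᵛ 31 ∷ᵛ 35 ∷ᵛ 15 ∷ᵛ 21 ∷ᵛ 27 ∷ᵛ 32 ∷ᵛ 36 ∷ᵛ 22 ∷ᵛ 28 ∷ᵛ 33 ∷ᵛ 37 ∷ᵛ []ᵛ)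
  ∷ []

geoMap : Vec ℕ 37 → Cell → Cell
geoMap t i = cell (lookup t i)

Distinct : Board → List ℕ → Set
Distinct s ls = Unique (map (λ k → s (cell k)) ls)

Valid : Board → Set
Valid s = All (Distinct s) rows × All (Distinct s) circles

GenStep : Board → Board → Set
GenStep s t =
    (Σ (Vec ℕ 37) λ g → g ∈ geometricSymmetries × (∀ i → t i ≡ s (geoMap g i)))
  ⊎ (Σ (Permutation′ 7) λ σ → ∀ i → t i ≡ σ ⟨$⟩ʳ s i)

SameOrbit : Board → Board → Set
SameOrbit = EqClosure GenStep

-- Every geometric symmetry maps each member of either family
-- injectively into a member of the same family, and a renaming of symbols preserves
-- distinctness, so validity is G-invariant; the same argument applies to the families of
-- pairs of cells congruent to a fixed pair.
--
-- Renaming symbols brings a valid board into normal form, with the symbols in order on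
-- the circle {1,2,5,6,7,11,12}.  A backtracking search over the other 30 cells returns a
-- list of partial boards that every normal valid board extends, and each entry of that
-- list turns out to be the normal form of a symmetric image of one of six representative
-- boards.  The representatives lie in six different orbits because they are told apart by
-- four G-invariant properties: whether no pair of cells congruent to {1,8}, {1,9}, {1,14}
-- or {1,15} carries equal symbols.

module Submission where

open import Defs
open import Data.Fin using (Fin)
open import Data.Product using (Σ; _×_)
open import Relation.Binary.PropositionalEquality using (_≡_)

open import Data.Bool using (Bool; true; false; if_then_else_)
open import Data.Bool.Properties using (T-≡) renaming (_≟_ to _≟ᵇ_)
open import Data.Empty using (⊥-elim)
open import Data.Fin using (zero; suc; toℕ; punchOut)
open import Data.Fin.Permutation as Perm using (Permutation′; _⟨$⟩ʳ_; _⟨$⟩ˡ_; permutation)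
open import Data.Fin.Properties
  using (any?; all?; punchOut-injective; injective⇒≤; fromℕ<-toℕ; toℕ<n) renaming (_≟_ to _≟ᶠ_)
open import Data.List as List using (List; []; _∷_; _++_; map; allFin; concatMap; filter)
open import Data.List.Properties using (map-∘; map-cong)
open import Data.List.Membership.Propositional using (_∈_; find)
open import Data.List.Membership.Propositional.Properties
  using (∈-map⁺; ∈-allFin; ∈-lookup; ∈-concatMap⁻; ∈-filter⁻)
open import Data.List.Relation.Unary.All as All using (All; []; _∷_)
open import Data.List.Relation.Unary.All.Properties using (++⁺; map⁺)
open import Data.List.Relation.Unary.AllPairs using ([]; _∷_)
open import Data.List.Relation.Unary.Any as Any using (Any; here; there)
open import Data.List.Relation.Unary.Any.Properties using (concatMap⁺)
open import Data.List.Relation.Unary.Unique.Propositional using (Unique)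
import Data.List.Relation.Unary.Unique.Propositional.Properties as Unique
import Data.List.Relation.Unary.Unique.DecPropositional as UniqueDec
open import Data.Maybe using (Maybe; just; nothing)
open import Data.Maybe.Properties using () renaming (≡-dec to ≡-decₘ)
open import Data.Nat using (ℕ; suc; _∸_; _≡ᵇ_; _<?_) renaming (_≟_ to _≟ℕ_)
open import Data.List.Membership.DecPropositional _≟ℕ_ using (_∈?_)
open import Data.Nat.DivMod using (_mod_)
open import Data.Nat.Properties using (≡ᵇ⇒≡; 1+n≰n)
open import Data.Product using (_,_; ∃; ∃₂; proj₁; proj₂)
open import Data.Sum using (inj₁; inj₂)
open import Data.Vec using (Vec; []; _∷_; lookup; tabulate)
open import Data.Vec.Properties using (tabulate-cong) renaming (≡-dec to ≡-decᵛ)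
open import Function using (_∘_; _⇔_; mk⇔)
open import Function.Bundles using (Injection; module Equivalence)
open import Function.Properties.Equivalence using (⇔-isEquivalence)
open import Function.Properties.Inverse using (↔⇒↣)
open import Relation.Binary.PropositionalEquality using (_≢_; refl; sym; trans; cong; subst)
open import Relation.Binary.Construct.Closure.Equivalence as EqClosure using (symmetric)
open import Relation.Binary.Construct.Closure.ReflexiveTransitive using (ε; _◅_; _◅◅_)
open import Relation.Binary.Construct.Closure.Symmetric using (fwd)
open import Relation.Nullary using (¬?; yes; no; does; contradiction)
open import Relation.Nullary.Decidable using (Dec; from-yes; _×-dec_; _→-dec_; does-⇔)

module _ {A B : Set} (f : A → B) where

  unique-map⇒injective-on : ∀ {xs x y} → Unique (map f xs) → x ∈ xs → y ∈ xs → f x ≡ f y → x ≡ y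
  unique-map⇒injective-on _           (here refl) (here refl) _ = refl
  unique-map⇒injective-on (fx∉ ∷ _)  (here refl) (there y∈)  e = ⊥-elim (All.lookup fx∉ (∈-map⁺ f y∈) e)
  unique-map⇒injective-on (fy∉ ∷ _)  (there x∈)  (here refl) e = ⊥-elim (All.lookup fy∉ (∈-map⁺ f x∈) (sym e))
  unique-map⇒injective-on (_ ∷ fxs!) (there x∈)  (there y∈)  e = unique-map⇒injective-on fxs! x∈ y∈ e

  injective-on⇒unique-map : ∀ {xs} → Unique xs → (∀ {x y} → x ∈ xs → y ∈ xs → f x ≡ f y → x ≡ y) →
                            Unique (map f xs)
  injective-on⇒unique-map []          _   = []
  injective-on⇒unique-map (x∉ ∷ xs!) inj =
    map⁺ (All.tabulate λ y∈ fx≡fy → All.lookup x∉ y∈ (inj (here refl) (there y∈) fx≡fy))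
    ∷ injective-on⇒unique-map xs! (λ x∈ y∈ → inj (there x∈) (there y∈))

  unique-map-⊆ : ∀ {xs ys} → Unique (map f ys) → Unique xs → All (_∈ ys) xs → Unique (map f xs)
  unique-map-⊆ fys! xs! xs⊆ys = injective-on⇒unique-map xs! λ x∈ y∈ →
    unique-map⇒injective-on fys! (All.lookup xs⊆ys x∈) (All.lookup xs⊆ys y∈)

lookup-injective : ∀ {A : Set} {xs : List A} → Unique xs →
                   ∀ {i j} → List.lookup xs i ≡ List.lookup xs j → i ≡ j
lookup-injective (_   ∷ _)   {zero}  {zero}  _  = refl
lookup-injective (x∉ ∷ _)   {zero}  {suc j} eq = ⊥-elim (All.lookup x∉ (∈-lookup j) eq)
lookup-injective (x∉ ∷ _)   {suc i} {zero}  eq = ⊥-elim (All.lookup x∉ (∈-lookup i) (sym eq))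
lookup-injective (_   ∷ xs!) {suc i} {suc j} eq = cong suc (lookup-injective xs! eq)

injective⇒surjective : ∀ {n} {f : Fin n → Fin n} → (∀ {x y} → f x ≡ f y → x ≡ y) →
                       ∀ y → ∃ λ x → f x ≡ y
injective⇒surjective {suc n} {f} f-injective y with any? (λ x → f x ≟ᶠ y)
... | yes found  = found
... | no  missed =
  contradiction (injective⇒≤ {f = λ x → punchOut (y≢f x)} punchOut∘f-injective) 1+n≰n
  where
  y≢f : ∀ x → y ≢ f x
  y≢f x y≡fx = missed (x , sym y≡fx)
  punchOut∘f-injective : ∀ {x x′} → punchOut (y≢f x) ≡ punchOut (y≢f x′) → x ≡ x′
  punchOut∘f-injective eq = f-injective (punchOut-injective (y≢f _) (y≢f _) eq)

injective⇒permutation : ∀ {n} (f : Fin n → Fin n) → (∀ {x y} → f x ≡ f y → x ≡ y) → Permutation′ n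
injective⇒permutation f f-injective =
  permutation f (proj₁ ∘ surjective) (proj₂ ∘ surjective)
                (λ x → f-injective (proj₂ (surjective (f x))))
  where
  surjective : ∀ y → ∃ λ x → f x ≡ y
  surjective = injective⇒surjective f-injective

distinct-cong : ∀ {s t l} → (∀ c → s c ≡ t c) → Distinct s l → Distinct t l
distinct-cong {l = l} s≗t = subst Unique (map-cong (s≗t ∘ cell) l)

AllDistinct : List (List ℕ) → Board → Set
AllDistinct F s = All (Distinct s) F

allDistinct? : ∀ F s → Dec (AllDistinct F s)
allDistinct? F s = All.all? (λ l → UniqueDec.unique? _≟ᶠ_ (map (s ∘ cell) l)) F

_·_ : Vec ℕ 37 → ℕ → ℕ
g · k = lookup g (cell k)

EmbedsInto : Vec ℕ 37 → List (List ℕ) → List ℕ → Set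
EmbedsInto g F l = Unique (map (g ·_) l) × Any (λ l′ → All (_∈ l′) (map (g ·_) l)) F

Preserves : Vec ℕ 37 → List (List ℕ) → Set
Preserves g F = All (EmbedsInto g F) F

preserves? : ∀ g F → Dec (Preserves g F)
preserves? g F = All.all? (λ l → UniqueDec.unique? _≟ℕ_ (map (g ·_) l)
                          ×-dec Any.any? (λ l′ → All.all? (_∈? l′) (map (g ·_) l)) F) F

SymmetryClosed : List (List ℕ) → Set
SymmetryClosed F = All (λ g → Preserves g F) geometricSymmetries

symmetryClosed? : ∀ F → Dec (SymmetryClosed F)
symmetryClosed? F = All.all? (λ g → preserves? g F) geometricSymmetries

allDistinct-geometric : ∀ {F s t} g → Preserves g F → (∀ c → t c ≡ s (geoMap g c)) →
                        AllDistinct F s → AllDistinct F t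
allDistinct-geometric {F} {s} {t} g g-preserves t≗ F-distinct = All.map image-distinct g-preserves
  where
  image-distinct : ∀ {l} → EmbedsInto g F l → Distinct t l
  image-distinct {l} (gl! , into) =
    let l′-distinct , gl⊆l′ = All.lookupAny F-distinct into in
    distinct-cong (sym ∘ t≗)
      (subst Unique (sym (map-∘ l)) (unique-map-⊆ (s ∘ cell) l′-distinct gl! gl⊆l′))

allDistinct-renaming : ∀ {F s t} (σ : Permutation′ 7) → (∀ c → t c ≡ σ ⟨$⟩ʳ s c) →
                       AllDistinct F s → AllDistinct F t
allDistinct-renaming {s = s} σ t≗ = All.map λ {l} s-distinct →
  distinct-cong (sym ∘ t≗)
    (subst Unique (sym (map-∘ l)) (Unique.map⁺ (Injection.injective (↔⇒↣ σ)) s-distinct))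

geometricSymmetries-inverse-closed :
  All (λ g → Any (λ g′ → All (λ c → geoMap g (geoMap g′ c) ≡ c) (allFin 37)) geometricSymmetries)
      geometricSymmetries
geometricSymmetries-inverse-closed = from-yes
  (All.all? (λ g → Any.any? (λ g′ → All.all? (λ c → geoMap g (geoMap g′ c) ≟ᶠ c) (allFin 37))
                            geometricSymmetries)
            geometricSymmetries)

genStep-sym : ∀ {s t} → GenStep s t → GenStep t s
genStep-sym {s} (inj₁ (g , g∈ , t≗)) =
  let g′ , g′∈ , g∘g′≗id = find (All.lookup geometricSymmetries-inverse-closed g∈) in
  inj₁ (g′ , g′∈ , λ c →
    sym (trans (t≗ (geoMap g′ c)) (cong s (All.lookup g∘g′≗id (∈-allFin c)))))
genStep-sym (inj₂ (σ , t≗)) =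
  inj₂ (Perm.flip σ , λ c → sym (trans (cong (σ ⟨$⟩ˡ_) (t≗ c)) (Perm.inverseˡ σ)))

orbit-invariant : (P : Board → Set) → (∀ {s t} → GenStep s t → P s → P t) →
                  ∀ {s t} → SameOrbit s t → P s ⇔ P t
orbit-invariant P step =
  EqClosure.gfold ⇔-isEquivalence P (λ s→t → mk⇔ (step s→t) (step (genStep-sym s→t)))

allDistinct-invariant : ∀ {F} → SymmetryClosed F →
                        ∀ {s t} → SameOrbit s t → AllDistinct F s ⇔ AllDistinct F t
allDistinct-invariant {F} closed = orbit-invariant (AllDistinct F) step
  where
  step : ∀ {s t} → GenStep s t → AllDistinct F s → AllDistinct F t
  step {s} (inj₁ (g , g∈ , t≗)) = allDistinct-geometric {s = s} g (All.lookup closed g∈) t≗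
  step {s} (inj₂ (σ , t≗))      = allDistinct-renaming {s = s} σ t≗

rows-closed : SymmetryClosed rows
rows-closed = from-yes (symmetryClosed? rows)

circles-closed : SymmetryClosed circles
circles-closed = from-yes (symmetryClosed? circles)

valid-invariant : (s t : Board) → SameOrbit s t → Valid s → Valid t
valid-invariant s t s∼t (rows-distinct , circles-distinct) =
  Equivalence.to (allDistinct-invariant rows-closed s∼t) rows-distinct ,
  Equivalence.to (allDistinct-invariant circles-closed s∼t) circles-distinct

valid? : ∀ s → Dec (Valid s)
valid? s = allDistinct? rows s ×-dec allDistinct? circles s

firstCircle : List ℕ
firstCircle = 1 ∷ 2 ∷ 5 ∷ 6 ∷ 7 ∷ 11 ∷ 12 ∷ []

firstCell : Fin 7 → Cell
firstCell k = cell (List.lookup firstCircle k)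

Normalised : Board → Set
Normalised s = ∀ k → s (firstCell k) ≡ k

firstCircle-injective : ∀ {s} → Valid s → ∀ {k l} → s (firstCell k) ≡ s (firstCell l) → k ≡ l
firstCircle-injective {s} (_ , circles-distinct) {k} {l} eq =
  lookup-injective (from-yes (UniqueDec.unique? _≟ℕ_ firstCircle))
    (unique-map⇒injective-on (s ∘ cell) (All.lookup circles-distinct (here refl))
                             (∈-lookup {xs = firstCircle} k) (∈-lookup {xs = firstCircle} l) eq)

firstCircleSymbols : (s : Board) → Valid s → Permutation′ 7
firstCircleSymbols s s-valid = injective⇒permutation (s ∘ firstCell) (firstCircle-injective {s} s-valid)

normalisingRenaming : (s : Board) → Valid s → Permutation′ 7
normalisingRenaming s s-valid = Perm.flip (firstCircleSymbols s s-valid)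

normalise : (s : Board) → Valid s → Board
normalise s s-valid c = normalisingRenaming s s-valid ⟨$⟩ʳ s c

normalise-normalised : ∀ s s-valid → Normalised (normalise s s-valid)
normalise-normalised s s-valid k = Perm.inverseˡ (firstCircleSymbols s s-valid)

normalise-sameOrbit : ∀ s s-valid → SameOrbit s (normalise s s-valid)
normalise-sameOrbit s s-valid = fwd (inj₂ (normalisingRenaming s s-valid , λ _ → refl)) ◅ ε

-- Partial boards are indexed by the paper's labels, so the search compares natural numbers.
Assignment : Set
Assignment = ℕ → Maybe Symbol

assign : ℕ → Symbol → Assignment → Assignment
assign k v a j = if j ≡ᵇ k then just v else a j

Extends : Board → Assignment → Set
Extends s a = ∀ k {v} → a k ≡ just v → s (cell k) ≡ v

extends-assign : ∀ {s a} k → Extends s a → Extends s (assign k (s (cell k)) a)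
extends-assign {s} k s⊇a j with j ≡ᵇ k in j≡ᵇk
... | true  = λ { refl → cong (s ∘ cell) (≡ᵇ⇒≡ j k (Equivalence.from T-≡ j≡ᵇk)) }
... | false = s⊇a j

-- A step fills one cell; it carries the labels of the cells sharing a row or circle with that
-- cell, so that the search does not recompute them at every node.
record Step : Set where
  constructor step
  field
    cellLabel  : ℕ
    neighbours : List ℕ
    candidates : List Symbol

Clash : Assignment → List ℕ → Symbol → Set
Clash a ns v = Any (λ j → a j ≡ just v) ns

clash? : ∀ a ns v → Dec (Clash a ns v)
clash? a ns v = Any.any? (λ j → ≡-decₘ _≟ᶠ_ (a j) (just v)) ns

search : List Step → Assignment → List Assignment
branch : ℕ → List ℕ → List Step → Assignment → Symbol → List Assignment

search []                    a = a ∷ []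
search (step k ns vs ∷ plan) a = concatMap (branch k ns plan a) vs

branch k ns plan a v with clash? a ns v
... | yes _ = []
... | no  _ = search plan (assign k v a)

Admissible : Board → Step → Set
Admissible s (step k ns vs) = s (cell k) ∈ vs × All (λ j → s (cell j) ≢ s (cell k)) ns

search-complete : ∀ {s} plan a → All (Admissible s) plan → Extends s a →
                  Any (Extends s) (search plan a)
search-complete []                        a []                              s⊇a = here s⊇a
search-complete {s} (step k ns vs ∷ plan) a ((sk∈vs , ns-differ) ∷ plan-ok) s⊇a =
  concatMap⁺ (branch k ns plan a) (Any.map (λ { refl → continue }) sk∈vs)
  where
  continue : Any (Extends s) (branch k ns plan a (s (cell k)))
  continue with clash? a ns (s (cell k))
  ... | yes clash =
    let j , j∈ , aj≡sk = find clash in ⊥-elim (All.lookup ns-differ j∈ (s⊇a j aj≡sk))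
  ... | no  _ =
    search-complete {s} plan (assign k (s (cell k)) a) plan-ok (extends-assign {s} k s⊇a)

othersOn : ℕ → List ℕ → List ℕ
othersOn k l with k ∈? l
... | yes _ = filter (λ j → ¬? (j ≟ℕ k)) l
... | no  _ = []

∈-othersOn⁻ : ∀ {j k l} → j ∈ othersOn k l → k ∈ l × j ∈ l × j ≢ k
∈-othersOn⁻ {k = k} {l} j∈ with k ∈? l
... | yes k∈l = k∈l , ∈-filter⁻ (λ i → ¬? (i ≟ℕ k)) j∈

neighboursIn : List (List ℕ) → ℕ → List ℕ
neighboursIn F k = concatMap (othersOn k) F

neighbours-differ : ∀ {F s k j} → AllDistinct F s → j ∈ neighboursIn F k → s (cell j) ≢ s (cell k)
neighbours-differ {F} {s} {k} {j} F-distinct j∈ sj≡sk =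
  let l-distinct , k∈l , j∈l , j≢k = All.lookupAny F-distinct through
  in j≢k (unique-map⇒injective-on (s ∘ cell) l-distinct j∈l k∈l sj≡sk)
  where
  through : Any (λ l → k ∈ l × j ∈ l × j ≢ k) F
  through = Any.map (∈-othersOn⁻ {j} {k}) (∈-concatMap⁻ (othersOn k) j∈)

-- Each cell is filled when many of its neighbours already are, which keeps the search small.
otherCells : List ℕ
otherCells = 3 ∷ 13 ∷ 18 ∷ 10 ∷ 14 ∷ 4 ∷ 8 ∷ 9 ∷ 15 ∷ 20 ∷ 19 ∷ 25 ∷ 26 ∷ 24 ∷ 27
           ∷ 31 ∷ 23 ∷ 28 ∷ 16 ∷ 17 ∷ 21 ∷ 22 ∷ 29 ∷ 30 ∷ 32 ∷ 33 ∷ 34 ∷ 35 ∷ 36 ∷ 37 ∷ []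

cellStep : ℕ → List Symbol → Step
cellStep k = step k (neighboursIn (rows ++ circles) k)

firstCircleStep : Fin 7 → Step
firstCircleStep k = cellStep (List.lookup firstCircle k) (k ∷ [])

otherCellStep : ℕ → Step
otherCellStep k = cellStep k (allFin 7)

plan : List Step
plan = map firstCircleStep (allFin 7) ++ map otherCellStep otherCells

normalisedSolutions : List Assignment
normalisedSolutions = search plan (λ _ → nothing)

normalisedSolutions-complete : ∀ {s} → Valid s → Normalised s → Any (Extends s) normalisedSolutions
normalisedSolutions-complete {s} (rows-distinct , circles-distinct) s-normalised =
  search-complete {s} plan (λ _ → nothing) (++⁺ firstCircle-admissible otherCells-admissible) (λ _ ())
  where
  differ : ∀ k → All (λ j → s (cell j) ≢ s (cell k)) (neighboursIn (rows ++ circles) k)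
  differ k = All.tabulate (neighbours-differ {s = s} {k = k} (++⁺ rows-distinct circles-distinct))
  firstCircle-admissible : All (Admissible s) (map firstCircleStep (allFin 7))
  firstCircle-admissible =
    map⁺ {f = firstCircleStep}
         (All.tabulate λ {k} _ → here (s-normalised k) , differ (List.lookup firstCircle k))
  otherCells-admissible : All (Admissible s) (map otherCellStep otherCells)
  otherCells-admissible =
    map⁺ {f = otherCellStep} (All.tabulate λ {k} _ → ∈-allFin (s (cell k)) , differ k)

-- Symbol d of the paper is d ∸ 1 : Fin 7; each board is listed row by row.
representativeDigits : Vec (Vec ℕ 37) 6
representativeDigits =
    ( 1 ∷ 2 ∷ 3 ∷ 4
      ∷ 3 ∷ 4 ∷ 5 ∷ 6 ∷ 7
      ∷ 5 ∷ 6 ∷ 7 ∷ 1 ∷ 2 ∷ 3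
      ∷ 7 ∷ 1 ∷ 2 ∷ 3 ∷ 4 ∷ 5 ∷ 6
      ∷ 3 ∷ 4 ∷ 5 ∷ 6 ∷ 7 ∷ 1
      ∷ 6 ∷ 7 ∷ 1 ∷ 2 ∷ 3
      ∷ 2 ∷ 3 ∷ 4 ∷ 5 ∷ [])
  ∷ ( 1 ∷ 2 ∷ 3 ∷ 6
      ∷ 3 ∷ 4 ∷ 5 ∷ 1 ∷ 7
      ∷ 5 ∷ 6 ∷ 7 ∷ 4 ∷ 2 ∷ 1
      ∷ 4 ∷ 7 ∷ 1 ∷ 2 ∷ 3 ∷ 6 ∷ 5
      ∷ 3 ∷ 2 ∷ 5 ∷ 6 ∷ 7 ∷ 4
      ∷ 6 ∷ 3 ∷ 4 ∷ 5 ∷ 1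
      ∷ 7 ∷ 1 ∷ 2 ∷ 3 ∷ [])
  ∷ ( 1 ∷ 2 ∷ 3 ∷ 6
      ∷ 3 ∷ 4 ∷ 5 ∷ 1 ∷ 7
      ∷ 5 ∷ 6 ∷ 7 ∷ 4 ∷ 2 ∷ 1
      ∷ 2 ∷ 7 ∷ 1 ∷ 5 ∷ 3 ∷ 6 ∷ 4
      ∷ 3 ∷ 4 ∷ 2 ∷ 6 ∷ 7 ∷ 5
      ∷ 6 ∷ 3 ∷ 5 ∷ 2 ∷ 1
      ∷ 7 ∷ 1 ∷ 4 ∷ 3 ∷ [])
  ∷ ( 1 ∷ 2 ∷ 3 ∷ 7
      ∷ 3 ∷ 4 ∷ 5 ∷ 1 ∷ 6
      ∷ 5 ∷ 6 ∷ 7 ∷ 4 ∷ 2 ∷ 1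
      ∷ 2 ∷ 7 ∷ 1 ∷ 6 ∷ 3 ∷ 5 ∷ 4
      ∷ 3 ∷ 4 ∷ 2 ∷ 5 ∷ 6 ∷ 7
      ∷ 6 ∷ 3 ∷ 7 ∷ 2 ∷ 1
      ∷ 5 ∷ 1 ∷ 4 ∷ 3 ∷ [])
  ∷ ( 1 ∷ 2 ∷ 3 ∷ 7
      ∷ 3 ∷ 4 ∷ 5 ∷ 6 ∷ 1
      ∷ 5 ∷ 6 ∷ 7 ∷ 4 ∷ 2 ∷ 3
      ∷ 2 ∷ 7 ∷ 1 ∷ 3 ∷ 6 ∷ 5 ∷ 4
      ∷ 3 ∷ 4 ∷ 2 ∷ 5 ∷ 1 ∷ 7
      ∷ 6 ∷ 1 ∷ 7 ∷ 2 ∷ 3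
      ∷ 5 ∷ 3 ∷ 4 ∷ 6 ∷ [])
  ∷ ( 1 ∷ 2 ∷ 3 ∷ 6
      ∷ 3 ∷ 4 ∷ 5 ∷ 1 ∷ 7
      ∷ 5 ∷ 6 ∷ 7 ∷ 4 ∷ 2 ∷ 3
      ∷ 4 ∷ 7 ∷ 2 ∷ 3 ∷ 1 ∷ 6 ∷ 5
      ∷ 3 ∷ 1 ∷ 5 ∷ 6 ∷ 7 ∷ 4
      ∷ 6 ∷ 2 ∷ 4 ∷ 5 ∷ 3
      ∷ 7 ∷ 3 ∷ 1 ∷ 2 ∷ [])
  ∷ []

representative : Fin 6 → Board
representative r c = (lookup (lookup representativeDigits r) c ∸ 1) mod 7

representative-valid : ∀ r → Valid (representative r)
representative-valid = from-yes (all? λ r → valid? (representative r))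

congruentPairs : ℕ → ℕ → List (List ℕ)
congruentPairs a b = map (λ g → g · a ∷ g · b ∷ []) geometricSymmetries

separator : Fin 4 → List (List ℕ)
separator i = congruentPairs 1 (lookup (8 ∷ 9 ∷ 14 ∷ 15 ∷ []) i)

separator-closed : ∀ i → SymmetryClosed (separator i)
separator-closed = from-yes (all? λ i → symmetryClosed? (separator i))

signature : Board → Vec Bool 4
signature s = tabulate λ i → does (allDistinct? (separator i) s)

signature-invariant : ∀ {s t} → SameOrbit s t → signature s ≡ signature t
signature-invariant {s} {t} s∼t = tabulate-cong λ i →
  does-⇔ (allDistinct-invariant (separator-closed i) s∼t)
         (allDistinct? (separator i) s) (allDistinct? (separator i) t)

signature-separates : ∀ r r′ → signature (representative r) ≡ signature (representative r′) → r ≡ r′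
signature-separates = from-yes (all? λ r → all? λ r′ →
  ≡-decᵛ _≟ᵇ_ (signature (representative r)) (signature (representative r′)) →-dec r ≟ᶠ r′)

representativeImage : Fin 6 → Fin 12 → Board
representativeImage r i = representative r ∘ geoMap (List.lookup geometricSymmetries i)

representativeImage-sameOrbit : ∀ r i → SameOrbit (representative r) (representativeImage r i)
representativeImage-sameOrbit r i =
  fwd (inj₁ (List.lookup geometricSymmetries i , ∈-lookup i , λ _ → refl)) ◅ ε

representativeImage-valid : ∀ r i → Valid (representativeImage r i)
representativeImage-valid r i =
  valid-invariant _ _ (representativeImage-sameOrbit r i) (representative-valid r)

label : Cell → ℕ
label c = suc (toℕ c)

cell-label : ∀ c → cell (label c) ≡ c
cell-label c with toℕ c <? 37
... | yes c<37 = fromℕ<-toℕ c c<37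
... | no  c≮37 = contradiction (toℕ<n c) c≮37

Matches : Assignment → Board → Set
Matches a s = All (λ c → a (label c) ≡ just (s c)) (allFin 37)

matches? : ∀ a s → Dec (Matches a s)
matches? a s = All.all? (λ c → ≡-decₘ _≟ᶠ_ (a (label c)) (just (s c))) (allFin 37)

normalisedSolutions-classified :
  All (λ a → ∃₂ λ r i → Matches a (normalise (representativeImage r i) (representativeImage-valid r i)))
      normalisedSolutions
normalisedSolutions-classified = from-yes (All.all? (λ a → any? λ r → any? λ i →
  matches? a (normalise (representativeImage r i) (representativeImage-valid r i))) normalisedSolutions)

extends-matches⇒≗ : ∀ {s a b} → Extends s a → Matches a b → ∀ c → s c ≡ b c
extends-matches⇒≗ {s} {b = b} s⊇a a≈b c =
  subst (λ x → s x ≡ b c) (cell-label c) (s⊇a (label c) (All.lookup a≈b (∈-allFin c)))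

≗⇒sameOrbit : ∀ {s t} → (∀ c → s c ≡ t c) → SameOrbit s t
≗⇒sameOrbit s≗t = fwd (inj₂ (Perm.id , sym ∘ s≗t)) ◅ ε

orbit-representative : (s : Board) → Valid s → Σ (Fin 6) λ r → SameOrbit s (representative r)
orbit-representative s s-valid =
  let s∼t          = normalise-sameOrbit s s-valid
      a , a∈ , t⊇a = find (normalisedSolutions-complete {normalise s s-valid}
                             (valid-invariant _ _ s∼t s-valid) (normalise-normalised s s-valid))
      r , i , a≈b  = All.lookup normalisedSolutions-classified a∈
      image∼normal = normalise-sameOrbit (representativeImage r i) (representativeImage-valid r i)
  in r , (s∼t ◅◅ ≗⇒sameOrbit (extends-matches⇒≗ t⊇a a≈b) ◅◅ symmetric GenStep image∼normal
              ◅◅ symmetric GenStep (representativeImage-sameOrbit r i))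

theorem4 : ((s t : Board) → SameOrbit s t → Valid s → Valid t)
           × (Σ (Fin 6 → Board) λ b →
                ((i : Fin 6) → Valid (b i))
                × ((i j : Fin 6) → SameOrbit (b i) (b j) → i ≡ j)
                × ((s : Board) → Valid s → Σ (Fin 6) λ i → SameOrbit s (b i)))
theorem4 = valid-invariant , representative , representative-valid ,
           (λ r r′ → signature-separates r r′ ∘ signature-invariant) , orbit-representative
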